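{- Let $K = K(n) \ge 2$. The minimum number of duplication-loss steps of width at most $K$ needed to obtain $\sigma$ from $12\ldots n$, averaged over all $\sigma \in S_n$ (uniform distribution), is $\Omega\left(\log n + \frac{n^2}{K^2}\right)$.
   Context: A duplication-loss step of width $k$ applied to a permutation $\pi$ chooses a contiguous fragment of $k$ consecutive positions and a subset $S$ of its entries, and replaces the fragment by the entries of $S$ in their original relative order followed by the remaining entries of the fragment in their original relative order. -}

module Defs where

open import Data.Nat using (ℕ; zero; suc; _≤_)
open import Data.Bool using (Bool; true; false)
open import Data.Fin using (Fin)
import Data.Fin.Properties as FinP
open import Data.List using (List; []; _∷_; _++_; length; map; concatMap; filter)
import Data.List as L
open import Data.Vec using (Vec; toList) renaming ([] to []ᵥ; _∷_ to _∷ᵥ_)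
open import Data.List.Relation.Unary.Unique.Propositional using (Unique)
import Data.List.Relation.Unary.Unique.DecPropositional as UD
open import Relation.Binary.PropositionalEquality using (_≡_)
open import Relation.Nullary using (¬_)

sel : ∀ {A : Set} → List Bool → List A → List A
sel (true  ∷ bs) (x ∷ xs) = x ∷ sel bs xs
sel (false ∷ bs) (x ∷ xs) = sel bs xs
sel _ _ = []

unsel : ∀ {A : Set} → List Bool → List A → List A
unsel (true  ∷ bs) (x ∷ xs) = unsel bs xs
unsel (false ∷ bs) (x ∷ xs) = x ∷ unsel bs xs
unsel _ _ = []

-- One duplication-loss step of width at most K turning xs into ys:
-- xs = pre ++ frag ++ suf with |frag| ≤ K, a subset S of frag given by a
-- mask of the same length, and ys = pre ++ S ++ (frag ∖ S) ++ suf.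
data DLStep {A : Set} (K : ℕ) (xs ys : List A) : Set where
  step : (pre frag suf : List A) (mask : List Bool) →
         length frag ≤ K →
         length mask ≡ length frag →
         xs ≡ pre ++ frag ++ suf →
         ys ≡ pre ++ sel mask frag ++ unsel mask frag ++ suf →
         DLStep K xs ys

data Reach {A : Set} (K : ℕ) : ℕ → List A → List A → Set where
  done : ∀ {xs} → Reach K zero xs xs
  more : ∀ {t xs ys zs} → DLStep K xs ys → Reach K t ys zs → Reach K (suc t) xs zs

IsMinSteps : ∀ {A : Set} → ℕ → List A → List A → ℕ → Set
IsMinSteps K xs ys m = Reach K m xs ys × (∀ t → t Data.Nat.< m → ¬ Reach K t xs ys)
  where open import Data.Product using (_×_)
        import Data.Nat

allVecs : ∀ {n} (m : ℕ) → List (Vec (Fin n) m)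
allVecs zero = []ᵥ ∷ []
allVecs {n} (suc m) = concatMap (λ i → map (i ∷ᵥ_) (allVecs m)) (L.allFin n)

-- S_n: permutations of {0,…,n-1} in one-line notation (σ(0) … σ(n-1)),
-- i.e. words of length n over Fin n with pairwise distinct entries.
Sn : (n : ℕ) → List (Vec (Fin n) n)
Sn n = filter (λ σ → UD.unique? FinP._≟_ (toList σ)) (allVecs n)

idPerm : (n : ℕ) → Vec (Fin n) n
idPerm n = Data.Vec.allFin n
  where import Data.Vec

-- Two statistics of a word over a totally ordered alphabet control how fast a
-- duplication-loss step of width at most K can scramble it. A step moves the
-- entries inside one block of at most K positions, so it creates at most K²
-- inversions; and since it splits a block into two subsequences, it at most
-- doubles the number of ascending runs (descents + 1), up to an additive
-- constant. Starting from the sorted word, t steps thus leave at most t K²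
-- inversions and fewer than 3·2ᵗ runs. Pairing σ with its complement
-- σ̄(i) = n + 1 − σ(i) turns every pair of positions into an inversion of σ or
-- of σ̄, and every adjacent pair into a descent of σ or of σ̄, so
-- d σ + d σ̄ ≥ max (C(n,2) / K², log₂ n − 3). Averaging over the pairs {σ, σ̄}
-- gives the bound.
module Submission where

import Algebra.Properties.CommutativeSemigroup as CommutativeSemigroup
open import Data.Bool using (Bool; true; false)
open import Data.Empty using (⊥-elim)
open import Data.Fin as Fin using (Fin; opposite)
import Data.Fin.Properties as Fin
open import Data.List
  using (List; []; _∷_; _++_; length; map; concatMap; cartesianProductWith; allFin; tabulate)
open import Data.List.Properties using (map-++; ++-assoc; map-∘)
open import Data.List.Membership.Propositional using (_∈_)
open import Data.List.Membership.Propositional.Properties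
  using (∈-map⁺; ∈-map⁻; ∈-filter⁺; ∈-filter⁻; ∈-allFin; ∈-cartesianProductWith⁺)
open import Data.List.Membership.Propositional.Properties.WithK using (unique∧set⇒bag)
open import Data.List.Relation.Binary.BagAndSetEquality using (∼bag⇒↭)
open import Data.List.Relation.Binary.Permutation.Propositional using (_↭_; ↭-refl; ↭-trans; ↭-prep)
open import Data.List.Relation.Binary.Permutation.Propositional.Properties
  using (shift; ++⁺ʳ; map⁺; ↭-length)
open import Data.List.Relation.Binary.Sublist.Propositional using (_⊆_; []; _∷_; _∷ʳ_; minimum)
open import Data.List.Relation.Unary.All using (All; []; _∷_)
open import Data.List.Relation.Unary.AllPairs using (AllPairs; []; _∷_)
import Data.List.Relation.Unary.AllPairs.Properties as AllPairs
open import Data.List.Relation.Unary.Any using (here; there)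
open import Data.List.Relation.Unary.Unique.Propositional using (Unique)
import Data.List.Relation.Unary.Unique.Propositional.Properties as Unique
import Data.List.Relation.Unary.Unique.DecPropositional as UniqueDec
open import Data.Nat using (ℕ; zero; suc; _≤_; _*_; _+_; _^_; z≤n; s≤s)
open import Data.Nat.Combinatorics using (_C_; nC1≡n; nCk+nC[k+1]≡[n+1]C[k+1])
open import Data.Nat.ListAction using (sum)
open import Data.Nat.ListAction.Properties using (sum-++; sum-↭)
open import Data.Nat.Logarithm using (⌊log₂_⌋; ⌊log₂⌋-mono-≤; ⌊log₂[2^n]⌋≡n)
open import Data.Nat.Properties hiding (_<?_; <-trans)
open import Data.Nat.Tactic.RingSolver using (solve-∀)
open import Data.Product using (Σ; _×_; _,_; proj₁; proj₂)
open import Data.Vec using (Vec; toList) renaming ([] to []ᵥ; _∷_ to _∷ᵥ_)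
import Data.Vec as Vec
import Data.Vec.Properties as Vec
open import Function using (_∘_)
open import Function.Bundles using (mk⇔)
open import Relation.Binary using (Rel; IsStrictTotalOrder; tri<; tri≈; tri>)
open import Relation.Binary.PropositionalEquality
open import Relation.Nullary using (¬_; Dec; yes; no)

open import Defs

open CommutativeSemigroup +-commutativeSemigroup using () renaming (interchange to +-interchange)

indicator : ∀ {p} {P : Set p} → Dec P → ℕ
indicator (yes _) = 1
indicator (no _)  = 0

indicator≤1 : ∀ {p} {P : Set p} (P? : Dec P) → indicator P? ≤ 1
indicator≤1 (yes _) = s≤s z≤n
indicator≤1 (no _)  = z≤n

indicator-yes : ∀ {p} {P : Set p} (P? : Dec P) → P → indicator P? ≡ 1
indicator-yes (yes _) _ = refl
indicator-yes (no ¬p) p = ⊥-elim (¬p p)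

indicator-no : ∀ {p} {P : Set p} (P? : Dec P) → ¬ P → indicator P? ≡ 0
indicator-no (yes p) ¬p = ⊥-elim (¬p p)
indicator-no (no _)  _  = refl

sum-map-+ : ∀ {A : Set} (f g : A → ℕ) xs →
            sum (map (λ x → f x + g x) xs) ≡ sum (map f xs) + sum (map g xs)
sum-map-+ f g []       = refl
sum-map-+ f g (x ∷ xs) = begin
  f x + g x + sum (map (λ x → f x + g x) xs)    ≡⟨ cong (f x + g x +_) (sum-map-+ f g xs) ⟩
  f x + g x + (sum (map f xs) + sum (map g xs)) ≡⟨ +-interchange (f x) (g x) _ _ ⟩
  f x + sum (map f xs) + (g x + sum (map g xs)) ∎
  where open ≡-Reasoning

length*≤*sum : ∀ {A : Set} {c} m (f : A → ℕ) xs → (∀ {x} → x ∈ xs → c ≤ m * f x) →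
               length xs * c ≤ m * sum (map f xs)
length*≤*sum m f []       _ = z≤n
length*≤*sum {c = c} m f (x ∷ xs) h = begin
  c + length xs * c           ≤⟨ +-mono-≤ (h (here refl)) (length*≤*sum m f xs (h ∘ there)) ⟩
  m * f x + m * sum (map f xs) ≡⟨ *-distribˡ-+ m (f x) _ ⟨
  m * (f x + sum (map f xs))   ∎
  where open ≤-Reasoning

map-involution-↭ : ∀ {A : Set} {f : A → A} {xs} → (∀ x → f (f x) ≡ x) →
                   Unique xs → (∀ {x} → x ∈ xs → f x ∈ xs) → map f xs ↭ xs
map-involution-↭ {f = f} {xs} f-involutive xs! f-closed =
  ∼bag⇒↭ (unique∧set⇒bag (Unique.map⁺ f-injective xs!) xs! (mk⇔ to from))
  where
  f-injective : ∀ {x y} → f x ≡ f y → x ≡ y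
  f-injective {x} {y} fx≡fy = trans (sym (f-involutive x)) (trans (cong f fx≡fy) (f-involutive y))
  to : ∀ {y} → y ∈ map f xs → y ∈ xs
  to y∈ with ∈-map⁻ f y∈
  ... | _ , x∈ , refl = f-closed x∈
  from : ∀ {y} → y ∈ xs → y ∈ map f xs
  from {y} y∈ = subst (_∈ map f xs) (f-involutive y) (∈-map⁺ f (f-closed y∈))

1≤m*n⇒1≤m : ∀ m {n} → 1 ≤ m * n → 1 ≤ m
1≤m*n⇒1≤m (suc m) _ = s≤s z≤n

C2-suc : ∀ m → suc m C 2 ≡ m + m C 2
C2-suc m = trans (sym (nCk+nC[k+1]≡[n+1]C[k+1] m 1)) (cong (_+ m C 2) (nC1≡n m))

n*n≡2*nC2+n : ∀ n → n * n ≡ 2 * (n C 2) + n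
n*n≡2*nC2+n zero    = refl
n*n≡2*nC2+n (suc m) = begin
  suc m * suc m                  ≡⟨ square-suc m ⟩
  m * m + (2 * m + 1)            ≡⟨ cong (_+ (2 * m + 1)) (n*n≡2*nC2+n m) ⟩
  2 * (m C 2) + m + (2 * m + 1)  ≡⟨ regroup m (m C 2) ⟩
  2 * (m + m C 2) + suc m        ≡⟨ cong (λ c → 2 * c + suc m) (C2-suc m) ⟨
  2 * (suc m C 2) + suc m        ∎
  where
  open ≡-Reasoning
  square-suc : ∀ m → suc m * suc m ≡ m * m + (2 * m + 1)
  square-suc = solve-∀
  regroup : ∀ m c → 2 * c + m + (2 * m + 1) ≡ 2 * (m + c) + suc m
  regroup = solve-∀

1≤nC2 : ∀ {n} → 2 ≤ n → 1 ≤ n C 2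
1≤nC2 {suc (suc m)} (s≤s (s≤s _)) = subst (1 ≤_) (sym (C2-suc (suc m))) (s≤s z≤n)

n≤2*nC2 : ∀ {n} → 2 ≤ n → n ≤ 2 * (n C 2)
n≤2*nC2 {suc (suc m)} (s≤s (s≤s _)) = begin
  suc (suc m)                    ≤⟨ s≤s (m≤n+m (suc m) m) ⟩
  suc m + suc m                  ≡⟨ cong (suc m +_) (+-identityʳ (suc m)) ⟨
  2 * suc m                      ≤⟨ *-monoʳ-≤ 2 (m≤m+n (suc m) _) ⟩
  2 * (suc m + suc m C 2)        ≡⟨ cong (2 *_) (C2-suc (suc m)) ⟨
  2 * (suc (suc m) C 2)          ∎
  where open ≤-Reasoning

n^2≤4*nC2 : ∀ {n} → 2 ≤ n → n ^ 2 ≤ 4 * (n C 2)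
n^2≤4*nC2 {n} 2≤n = begin
  n ^ 2                      ≡⟨ cong (n *_) (*-identityʳ n) ⟩
  n * n                      ≡⟨ n*n≡2*nC2+n n ⟩
  2 * (n C 2) + n            ≤⟨ +-monoʳ-≤ (2 * (n C 2)) (n≤2*nC2 2≤n) ⟩
  2 * (n C 2) + 2 * (n C 2)  ≡⟨ double (n C 2) ⟩
  4 * (n C 2)                ∎
  where
  open ≤-Reasoning
  double : ∀ c → 2 * c + 2 * c ≡ 4 * c
  double = solve-∀

n≤2^[t+t′+3] : ∀ {n D D′} t t′ → n ≤ D + suc D′ → D + 3 ≤ 2 ^ t * 3 → D′ + 3 ≤ 2 ^ t′ * 3 →
            n ≤ 2 ^ (t + t′ + 3)
n≤2^[t+t′+3] {n} {D} {D′} t t′ n≤ D≤ D′≤ = begin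
  n                                  ≤⟨ m≤m+n n 5 ⟩
  n + 5                              ≤⟨ +-monoˡ-≤ 5 n≤ ⟩
  D + suc D′ + 5                     ≡⟨ regroup D D′ ⟩
  (D + 3) + (D′ + 3)                 ≤⟨ +-mono-≤ D≤ D′≤ ⟩
  2 ^ t * 3 + 2 ^ t′ * 3             ≤⟨ +-mono-≤ (*-monoˡ-≤ 3 (^-monoʳ-≤ 2 (m≤m+n t t′)))
                                                  (*-monoˡ-≤ 3 (^-monoʳ-≤ 2 (m≤n+m t′ t))) ⟩
  2 ^ s * 3 + 2 ^ s * 3              ≤⟨ m≤m+n _ (2 ^ s * 2) ⟩
  2 ^ s * 3 + 2 ^ s * 3 + 2 ^ s * 2  ≡⟨ eight (2 ^ s) ⟩
  2 ^ s * 2 ^ 3                      ≡⟨ ^-distribˡ-+-* 2 s 3 ⟨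
  2 ^ (s + 3)                        ∎
  where
  open ≤-Reasoning
  s = t + t′
  regroup : ∀ a b → a + suc b + 5 ≡ (a + 3) + (b + 3)
  regroup = solve-∀
  eight : ∀ p → p * 3 + p * 3 + p * 2 ≡ p * 8
  eight = solve-∀

⌊log₂⌋≤4* : ∀ {n s} → 1 ≤ s → n ≤ 2 ^ (s + 3) → ⌊log₂ n ⌋ ≤ 4 * s
⌊log₂⌋≤4* {n} {s} 1≤s n≤ = begin
  ⌊log₂ n ⌋              ≤⟨ ⌊log₂⌋-mono-≤ n≤ ⟩
  ⌊log₂ (2 ^ (s + 3)) ⌋  ≡⟨ ⌊log₂[2^n]⌋≡n (s + 3) ⟩
  s + 3                  ≤⟨ +-monoʳ-≤ s (*-monoʳ-≤ 3 1≤s) ⟩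
  s + 3 * s              ≡⟨ four s ⟩
  4 * s                  ∎
  where
  open ≤-Reasoning
  four : ∀ s → s + 3 * s ≡ 4 * s
  four = solve-∀

module _ {A : Set} where

  sel-⊆ : ∀ (mask : List Bool) (xs : List A) → sel mask xs ⊆ xs
  sel-⊆ []           xs       = minimum xs
  sel-⊆ (true ∷ _)   []       = []
  sel-⊆ (false ∷ _)  []       = []
  sel-⊆ (true ∷ m)   (x ∷ xs) = refl ∷ sel-⊆ m xs
  sel-⊆ (false ∷ m)  (x ∷ xs) = x ∷ʳ sel-⊆ m xs

  unsel-⊆ : ∀ (mask : List Bool) (xs : List A) → unsel mask xs ⊆ xs
  unsel-⊆ []          xs       = minimum xs
  unsel-⊆ (true ∷ _)  []       = []
  unsel-⊆ (false ∷ _) []       = []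
  unsel-⊆ (true ∷ m)  (x ∷ xs) = x ∷ʳ unsel-⊆ m xs
  unsel-⊆ (false ∷ m) (x ∷ xs) = refl ∷ unsel-⊆ m xs

  sel++unsel-↭ : ∀ (mask : List Bool) (xs : List A) → length mask ≡ length xs →
                 sel mask xs ++ unsel mask xs ↭ xs
  sel++unsel-↭ []          []       _ = ↭-refl
  sel++unsel-↭ (true ∷ m)  (x ∷ xs) e = ↭-prep x (sel++unsel-↭ m xs (suc-injective e))
  sel++unsel-↭ (false ∷ m) (x ∷ xs) e =
    ↭-trans (shift x (sel m xs) (unsel m xs)) (↭-prep x (sel++unsel-↭ m xs (suc-injective e)))

module OrderStatistics {ℓ} {A : Set} {_<_ : Rel A ℓ}
                       (<-isStrictTotalOrder : IsStrictTotalOrder _≡_ _<_) where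

  open IsStrictTotalOrder <-isStrictTotalOrder using (compare; _<?_; asym) renaming (trans to <-trans)

  [_≻_] : A → A → ℕ
  [ x ≻ y ] = indicator (y <? x)

  <-≮-trans : ∀ {x y z} → z < x → ¬ y < x → z < y
  <-≮-trans {x} {y} z<x y≮x with compare x y
  ... | tri< x<y _ _  = <-trans z<x x<y
  ... | tri≈ _ refl _ = z<x
  ... | tri> _ _ y<x  = ⊥-elim (y≮x y<x)

  ≻-triangle : ∀ x y z → [ x ≻ z ] ≤ [ x ≻ y ] + [ y ≻ z ]
  ≻-triangle x y z with z <? x | y <? x | z <? y
  ... | no _    | _      | _      = z≤n
  ... | yes _   | yes _  | _      = s≤s z≤n
  ... | yes _   | no _   | yes _  = s≤s z≤n
  ... | yes z<x | no y≮x | no z≮y = ⊥-elim (z≮y (<-≮-trans z<x y≮x))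

  descents : List A → ℕ
  descents (x ∷ y ∷ zs) = [ x ≻ y ] + descents (y ∷ zs)
  descents _            = 0

  descents-∷ : ∀ y ys → descents ys ≤ descents (y ∷ ys)
  descents-∷ y []       = z≤n
  descents-∷ y (z ∷ zs) = m≤n+m _ _

  descents-drop-second : ∀ x y zs → descents (x ∷ zs) ≤ descents (x ∷ y ∷ zs)
  descents-drop-second x y []       = z≤n
  descents-drop-second x y (z ∷ zs) = begin
    [ x ≻ z ] + descents (z ∷ zs)               ≤⟨ +-monoˡ-≤ _ (≻-triangle x y z) ⟩
    [ x ≻ y ] + [ y ≻ z ] + descents (z ∷ zs)   ≡⟨ +-assoc [ x ≻ y ] _ _ ⟩
    [ x ≻ y ] + ([ y ≻ z ] + descents (z ∷ zs)) ∎
    where open ≤-Reasoning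

  descents-mono-⊆-∷ : ∀ x {xs ys} → xs ⊆ ys → descents (x ∷ xs) ≤ descents (x ∷ ys)
  descents-mono-⊆-∷ x []                   = ≤-refl
  descents-mono-⊆-∷ x (_∷ʳ_ {ys = ys} y p) = ≤-trans (descents-mono-⊆-∷ x p) (descents-drop-second x y ys)
  descents-mono-⊆-∷ x (_∷_ {y = y} refl p) = +-monoʳ-≤ [ x ≻ y ] (descents-mono-⊆-∷ y p)

  descents-mono-⊆ : ∀ {xs ys} → xs ⊆ ys → descents xs ≤ descents ys
  descents-mono-⊆ []                   = z≤n
  descents-mono-⊆ (_∷ʳ_ {ys = ys} y p) = ≤-trans (descents-mono-⊆ p) (descents-∷ y ys)
  descents-mono-⊆ (_∷_ {x = x} refl p) = descents-mono-⊆-∷ x p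

  descents-++-≤ : ∀ xs ys → descents (xs ++ ys) ≤ descents xs + suc (descents ys)
  descents-++-≤ []           ys       = n≤1+n _
  descents-++-≤ (x ∷ [])     []       = z≤n
  descents-++-≤ (x ∷ [])     (y ∷ ys) = +-monoˡ-≤ _ (indicator≤1 (y <? x))
  descents-++-≤ (x ∷ y ∷ xs) ys       = begin
    [ x ≻ y ] + descents ((y ∷ xs) ++ ys)               ≤⟨ +-monoʳ-≤ [ x ≻ y ] (descents-++-≤ (y ∷ xs) ys) ⟩
    [ x ≻ y ] + (descents (y ∷ xs) + suc (descents ys)) ≡⟨ +-assoc [ x ≻ y ] _ _ ⟨
    [ x ≻ y ] + descents (y ∷ xs) + suc (descents ys)   ∎
    where open ≤-Reasoning

  descents-++-≥ : ∀ xs ys → descents xs + descents ys ≤ descents (xs ++ ys)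
  descents-++-≥ []           ys = ≤-refl
  descents-++-≥ (x ∷ [])     ys = descents-∷ x ys
  descents-++-≥ (x ∷ y ∷ xs) ys =
    ≤-trans (≤-reflexive (+-assoc [ x ≻ y ] _ _)) (+-monoʳ-≤ [ x ≻ y ] (descents-++-≥ (y ∷ xs) ys))

  descents-DLStep : ∀ {K xs ys} → DLStep K xs ys → descents ys + 3 ≤ 2 * (descents xs + 3)
  descents-DLStep (step pre frag suf mask _ _ refl refl) = begin
    D (pre ++ S ++ T ++ suf) + 3                 ≤⟨ +-monoˡ-≤ 3 four-blocks ⟩
    D pre + suc (D S + suc (D T + suc (D suf))) + 3
      ≤⟨ +-monoˡ-≤ 3 (+-monoʳ-≤ (D pre) (s≤s (+-mono-≤ S≤frag (s≤s (+-monoˡ-≤ _ T≤frag))))) ⟩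
    D pre + suc (D frag + suc (D frag + suc (D suf))) + 3 ≤⟨ m≤m+n _ (D pre + D suf) ⟩
    D pre + suc (D frag + suc (D frag + suc (D suf))) + 3 + (D pre + D suf)
      ≡⟨ regroup (D pre) (D frag) (D suf) ⟩
    2 * ((D pre + D frag + D suf) + 3)           ≤⟨ *-monoʳ-≤ 2 (+-monoˡ-≤ 3 three-blocks) ⟩
    2 * (D (pre ++ frag ++ suf) + 3)             ∎
    where
    open ≤-Reasoning
    D = descents
    S = sel mask frag
    T = unsel mask frag
    S≤frag : D S ≤ D frag
    S≤frag = descents-mono-⊆ (sel-⊆ mask frag)
    T≤frag : D T ≤ D frag
    T≤frag = descents-mono-⊆ (unsel-⊆ mask frag)
    four-blocks : D (pre ++ S ++ T ++ suf) ≤ D pre + suc (D S + suc (D T + suc (D suf)))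
    four-blocks = ≤-trans (descents-++-≤ pre _) (+-monoʳ-≤ (D pre) (s≤s
                    (≤-trans (descents-++-≤ S _) (+-monoʳ-≤ (D S) (s≤s (descents-++-≤ T suf))))))
    three-blocks : D pre + D frag + D suf ≤ D (pre ++ frag ++ suf)
    three-blocks = ≤-trans (≤-reflexive (+-assoc (D pre) _ _))
                     (≤-trans (+-monoʳ-≤ (D pre) (descents-++-≥ frag suf)) (descents-++-≥ pre _))
    regroup : ∀ p f s → p + suc (f + suc (f + suc s)) + 3 + (p + s) ≡ 2 * ((p + f + s) + 3)
    regroup = solve-∀

  descents-Reach : ∀ {K t xs ys} → Reach K t xs ys → descents ys + 3 ≤ 2 ^ t * (descents xs + 3)
  descents-Reach done = ≤-reflexive (sym (*-identityˡ _))
  descents-Reach {t = suc t} {xs} (more {ys = ys} s r) = begin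
    _                               ≤⟨ descents-Reach r ⟩
    2 ^ t * (descents ys + 3)       ≤⟨ *-monoʳ-≤ (2 ^ t) (descents-DLStep s) ⟩
    2 ^ t * (2 * (descents xs + 3)) ≡⟨ *-assoc (2 ^ t) 2 _ ⟨
    2 ^ t * 2 * (descents xs + 3)   ≡⟨ cong (_* (descents xs + 3)) (*-comm (2 ^ t) 2) ⟩
    2 ^ suc t * (descents xs + 3)   ∎
    where open ≤-Reasoning

  below : A → List A → ℕ
  below x ys = sum (map [ x ≻_] ys)

  below-++ : ∀ x ys zs → below x (ys ++ zs) ≡ below x ys + below x zs
  below-++ x ys zs = trans (cong sum (map-++ [ x ≻_] ys zs)) (sum-++ (map [ x ≻_] ys) _)

  below-↭ : ∀ x {ys zs} → ys ↭ zs → below x ys ≡ below x zs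
  below-↭ x ys↭zs = sum-↭ (map⁺ [ x ≻_] ys↭zs)

  below≤length : ∀ x ys → below x ys ≤ length ys
  below≤length x []       = z≤n
  below≤length x (y ∷ ys) = +-mono-≤ (indicator≤1 (y <? x)) (below≤length x ys)

  inversions : List A → ℕ
  inversions []       = 0
  inversions (x ∷ xs) = below x xs + inversions xs

  inversionsBetween : List A → List A → ℕ
  inversionsBetween xs ys = sum (map (λ x → below x ys) xs)

  inversionsBetween-↭ˡ : ∀ {xs xs′} ys → xs ↭ xs′ → inversionsBetween xs ys ≡ inversionsBetween xs′ ys
  inversionsBetween-↭ˡ ys xs↭xs′ = sum-↭ (map⁺ (λ x → below x ys) xs↭xs′)

  inversionsBetween-↭ʳ : ∀ xs {ys ys′} → ys ↭ ys′ → inversionsBetween xs ys ≡ inversionsBetween xs ys′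
  inversionsBetween-↭ʳ []       _      = refl
  inversionsBetween-↭ʳ (x ∷ xs) ys↭ys′ =
    cong₂ _+_ (below-↭ x ys↭ys′) (inversionsBetween-↭ʳ xs ys↭ys′)

  inversions-++ : ∀ xs ys → inversions (xs ++ ys) ≡ inversions xs + inversions ys + inversionsBetween xs ys
  inversions-++ []       ys = sym (+-identityʳ _)
  inversions-++ (x ∷ xs) ys = begin
    below x (xs ++ ys) + inversions (xs ++ ys)
      ≡⟨ cong₂ _+_ (below-++ x xs ys) (inversions-++ xs ys) ⟩
    below x xs + below x ys + (inversions xs + inversions ys + inversionsBetween xs ys)
      ≡⟨ regroup (below x xs) (below x ys) (inversions xs) (inversions ys) _ ⟩
    below x xs + inversions xs + inversions ys + (below x ys + inversionsBetween xs ys) ∎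
    where
    open ≡-Reasoning
    regroup : ∀ p q r s u → p + q + (r + s + u) ≡ p + r + s + (q + u)
    regroup = solve-∀

  inversions≤length² : ∀ xs → inversions xs ≤ length xs * length xs
  inversions≤length² []       = z≤n
  inversions≤length² (x ∷ xs) = begin
    below x xs + inversions xs                ≤⟨ +-mono-≤ (below≤length x xs) (inversions≤length² xs) ⟩
    length xs + length xs * length xs         ≤⟨ m≤n+m _ (suc (length xs)) ⟩
    suc (length xs) + (length xs + length xs * length xs)
      ≡⟨ cong (λ m → suc (length xs + m)) (*-suc (length xs) (length xs)) ⟨
    suc (length xs) * suc (length xs)         ∎
    where open ≤-Reasoning

  inversions-infix-↭ : ∀ pre suf {g f} → g ↭ f →
    inversions (pre ++ g ++ suf) + inversions f ≡ inversions (pre ++ f ++ suf) + inversions g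
  inversions-infix-↭ pre suf {g} {f} g↭f = begin
    inversions (pre ++ g ++ suf) + inversions f ≡⟨ cong (_+ inversions f) (split g) ⟩
    inversions g + outside g + inversions f     ≡⟨ cong (λ o → inversions g + o + inversions f) outside-↭ ⟩
    inversions g + outside f + inversions f     ≡⟨ swap (inversions g) _ _ ⟩
    inversions f + outside f + inversions g     ≡⟨ cong (_+ inversions g) (split f) ⟨
    inversions (pre ++ f ++ suf) + inversions g ∎
    where
    open ≡-Reasoning
    outside : List A → ℕ
    outside h = inversions pre + inversions suf + inversionsBetween h suf + inversionsBetween pre (h ++ suf)
    regroup : ∀ p h s u v → p + (h + s + u) + v ≡ h + (p + s + u + v)
    regroup = solve-∀
    swap : ∀ a o b → a + o + b ≡ b + o + a
    swap = solve-∀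
    split : ∀ h → inversions (pre ++ h ++ suf) ≡ inversions h + outside h
    split h = begin
      inversions (pre ++ h ++ suf)
        ≡⟨ inversions-++ pre (h ++ suf) ⟩
      inversions pre + inversions (h ++ suf) + inversionsBetween pre (h ++ suf)
        ≡⟨ cong (λ i → inversions pre + i + inversionsBetween pre (h ++ suf)) (inversions-++ h suf) ⟩
      inversions pre + (inversions h + inversions suf + inversionsBetween h suf) + inversionsBetween pre (h ++ suf)
        ≡⟨ regroup (inversions pre) (inversions h) _ _ _ ⟩
      inversions h + outside h ∎
    outside-↭ : outside g ≡ outside f
    outside-↭ = cong₂ (λ u v → inversions pre + inversions suf + u + v)
                  (inversionsBetween-↭ˡ suf g↭f) (inversionsBetween-↭ʳ pre (++⁺ʳ suf g↭f))

  inversions-DLStep : ∀ {K xs ys} → DLStep K xs ys → inversions ys ≤ inversions xs + K ^ 2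
  inversions-DLStep {K} (step pre frag suf mask |frag|≤K |mask|≡|frag| refl refl) =
    +-cancelʳ-≤ (inversions frag) _ _ (begin
      inversions (pre ++ S ++ T ++ suf) + inversions frag
        ≡⟨ cong (λ l → inversions (pre ++ l) + inversions frag) (++-assoc S T suf) ⟨
      inversions (pre ++ (S ++ T) ++ suf) + inversions frag
        ≡⟨ inversions-infix-↭ pre suf ST↭frag ⟩
      inversions (pre ++ frag ++ suf) + inversions (S ++ T)
        ≤⟨ +-monoʳ-≤ _ ST-bound ⟩
      inversions (pre ++ frag ++ suf) + K ^ 2
        ≤⟨ m≤m+n _ (inversions frag) ⟩
      inversions (pre ++ frag ++ suf) + K ^ 2 + inversions frag ∎)
    where
    open ≤-Reasoning
    S = sel mask frag
    T = unsel mask frag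
    ST↭frag : S ++ T ↭ frag
    ST↭frag = sel++unsel-↭ mask frag |mask|≡|frag|
    |ST|≤K : length (S ++ T) ≤ K
    |ST|≤K = ≤-trans (≤-reflexive (↭-length ST↭frag)) |frag|≤K
    ST-bound : inversions (S ++ T) ≤ K ^ 2
    ST-bound = ≤-trans (inversions≤length² (S ++ T))
                 (≤-trans (*-mono-≤ |ST|≤K |ST|≤K) (≤-reflexive (cong (K *_) (sym (*-identityʳ K)))))

  inversions-Reach : ∀ {K t xs ys} → Reach K t xs ys → inversions ys ≤ inversions xs + t * K ^ 2
  inversions-Reach done = ≤-reflexive (sym (+-identityʳ _))
  inversions-Reach {K} {suc t} {xs} (more {ys = ys} s r) = begin
    _                                ≤⟨ inversions-Reach r ⟩
    inversions ys + t * K ^ 2        ≤⟨ +-monoˡ-≤ (t * K ^ 2) (inversions-DLStep s) ⟩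
    inversions xs + K ^ 2 + t * K ^ 2 ≡⟨ +-assoc (inversions xs) _ _ ⟩
    inversions xs + suc t * K ^ 2    ∎
    where open ≤-Reasoning

  [≻]≡0 : ∀ {x y} → x < y → [ x ≻ y ] ≡ 0
  [≻]≡0 {x} {y} x<y = indicator-no (y <? x) (asym x<y)

  descents-sorted : ∀ {xs} → AllPairs _<_ xs → descents xs ≡ 0
  descents-sorted []                        = refl
  descents-sorted (_ ∷ [])                  = refl
  descents-sorted ((x<y ∷ _) ∷ y∷zs-sorted) = cong₂ _+_ ([≻]≡0 x<y) (descents-sorted y∷zs-sorted)

  below-All : ∀ {x ys} → All (x <_) ys → below x ys ≡ 0
  below-All []           = refl
  below-All (x<y ∷ x<ys) = cong₂ _+_ ([≻]≡0 x<y) (below-All x<ys)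

  inversions-sorted : ∀ {xs} → AllPairs _<_ xs → inversions xs ≡ 0
  inversions-sorted []                = refl
  inversions-sorted (x<xs ∷ xs-sorted) = cong₂ _+_ (below-All x<xs) (inversions-sorted xs-sorted)

  module _ {f : A → A} (f-reverses : ∀ {x y} → x < y → f y < f x) where

    ≻-complementary : ∀ {x y} → x ≢ y → 1 ≤ [ x ≻ y ] + [ f x ≻ f y ]
    ≻-complementary {x} {y} x≢y with compare x y
    ... | tri< x<y _ _  rewrite indicator-yes (f y <? f x) (f-reverses x<y) = m≤n+m 1 _
    ... | tri≈ _ x≡y _  = ⊥-elim (x≢y x≡y)
    ... | tri> _ _ y<x  rewrite indicator-yes (y <? x) y<x = s≤s z≤n

    descents-complementary : ∀ xs → Unique xs → length xs ≤ descents xs + suc (descents (map f xs))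
    descents-complementary []           _ = z≤n
    descents-complementary (x ∷ [])     _ = ≤-refl
    descents-complementary (x ∷ y ∷ zs) ((x≢y ∷ _) ∷ y∷zs!) = begin
      suc (suc (length zs))
        ≤⟨ +-mono-≤ (≻-complementary x≢y) (descents-complementary (y ∷ zs) y∷zs!) ⟩
      [ x ≻ y ] + [ f x ≻ f y ] + (descents (y ∷ zs) + suc (descents (map f (y ∷ zs))))
        ≡⟨ regroup [ x ≻ y ] [ f x ≻ f y ] _ _ ⟩
      [ x ≻ y ] + descents (y ∷ zs) + suc ([ f x ≻ f y ] + descents (map f (y ∷ zs))) ∎
      where
      open ≤-Reasoning
      regroup : ∀ a b c d → a + b + (c + suc d) ≡ a + c + suc (b + d)
      regroup = solve-∀

    below-complementary : ∀ x ys → All (x ≢_) ys → length ys ≤ below x ys + below (f x) (map f ys)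
    below-complementary x []       _ = z≤n
    below-complementary x (y ∷ ys) (x≢y ∷ x≢ys) = begin
      suc (length ys)
        ≤⟨ +-mono-≤ (≻-complementary x≢y) (below-complementary x ys x≢ys) ⟩
      [ x ≻ y ] + [ f x ≻ f y ] + (below x ys + below (f x) (map f ys))
        ≡⟨ +-interchange [ x ≻ y ] _ _ _ ⟩
      [ x ≻ y ] + below x ys + ([ f x ≻ f y ] + below (f x) (map f ys)) ∎
      where open ≤-Reasoning

    inversions-complementary : ∀ xs → Unique xs → length xs C 2 ≤ inversions xs + inversions (map f xs)
    inversions-complementary []       _ = z≤n
    inversions-complementary (x ∷ xs) (x≢xs ∷ xs!) = begin
      suc (length xs) C 2
        ≡⟨ C2-suc (length xs) ⟩
      length xs + length xs C 2
        ≤⟨ +-mono-≤ (below-complementary x xs x≢xs) (inversions-complementary xs xs!) ⟩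
      below x xs + below (f x) (map f xs) + (inversions xs + inversions (map f xs))
        ≡⟨ +-interchange (below x xs) _ _ _ ⟩
      below x xs + inversions xs + (below (f x) (map f xs) + inversions (map f xs)) ∎
      where open ≤-Reasoning

opposite-< : ∀ {n} {i j : Fin n} → i Fin.< j → opposite j Fin.< opposite i
opposite-< {n} {i} {j} i<j rewrite Fin.opposite-prop i | Fin.opposite-prop j =
  ∸-monoʳ-< (s≤s i<j) (Fin.toℕ<n j)

module _ {n : ℕ} where

  complement : ∀ {m} → Vec (Fin n) m → Vec (Fin n) m
  complement = Vec.map opposite

  complement-involutive : ∀ {m} (σ : Vec (Fin n) m) → complement (complement σ) ≡ σ
  complement-involutive []ᵥ       = refl
  complement-involutive (x ∷ᵥ σ) = cong₂ _∷ᵥ_ (Fin.opposite-involutive x) (complement-involutive σ)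

  toList-complement : ∀ {m} (σ : Vec (Fin n) m) → toList (complement σ) ≡ map opposite (toList σ)
  toList-complement = Vec.toList-map opposite

  complement-unique : ∀ {m} (σ : Vec (Fin n) m) → Unique (toList σ) → Unique (toList (complement σ))
  complement-unique σ σ! =
    subst Unique (sym (toList-complement σ)) (Unique.map⁺ opposite-injective σ!)
    where
    opposite-injective : ∀ {i j : Fin n} → opposite i ≡ opposite j → i ≡ j
    opposite-injective {i} {j} e =
      trans (sym (Fin.opposite-involutive i)) (trans (cong opposite e) (Fin.opposite-involutive j))

  idPerm-sorted : AllPairs Fin._<_ (toList (idPerm n))
  idPerm-sorted = subst (AllPairs Fin._<_) (sym (toList-tabulate (λ i → i)))
                    (AllPairs.tabulate⁺-< (λ i<j → i<j))
    where
    toList-tabulate : ∀ {m} (g : Fin m → Fin n) → toList (Vec.tabulate g) ≡ tabulate g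
    toList-tabulate {zero}  g = refl
    toList-tabulate {suc m} g = cong (g Fin.zero ∷_) (toList-tabulate (g ∘ Fin.suc))

concatMap-map≡cartesianProductWith : ∀ {A B C : Set} (f : A → B → C) xs ys →
  concatMap (λ x → map (f x) ys) xs ≡ cartesianProductWith f xs ys
concatMap-map≡cartesianProductWith f []       ys = refl
concatMap-map≡cartesianProductWith f (x ∷ xs) ys =
  cong (map (f x) ys ++_) (concatMap-map≡cartesianProductWith f xs ys)

module _ {n : ℕ} where

  allVecs-suc : ∀ m → allVecs {n} (suc m) ≡ cartesianProductWith _∷ᵥ_ (allFin n) (allVecs m)
  allVecs-suc m = concatMap-map≡cartesianProductWith _∷ᵥ_ (allFin n) (allVecs m)

  ∈-allVecs : ∀ m (v : Vec (Fin n) m) → v ∈ allVecs m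
  ∈-allVecs zero    []ᵥ      = here refl
  ∈-allVecs (suc m) (x ∷ᵥ v) =
    subst (_ ∈_) (sym (allVecs-suc m)) (∈-cartesianProductWith⁺ _∷ᵥ_ (∈-allFin x) (∈-allVecs m v))

  allVecs-unique : ∀ m → Unique (allVecs {n} m)
  allVecs-unique zero    = [] ∷ []
  allVecs-unique (suc m) = subst Unique (sym (allVecs-suc m))
    (Unique.cartesianProductWith⁺ _∷ᵥ_ Vec.∷-injective (Unique.allFin⁺ n) (allVecs-unique m))

  private
    unique? : (σ : Vec (Fin n) n) → Dec (Unique (toList σ))
    unique? σ = UniqueDec.unique? Fin._≟_ (toList σ)

  ∈-Sn⁺ : ∀ {σ : Vec (Fin n) n} → Unique (toList σ) → σ ∈ Sn n
  ∈-Sn⁺ {σ} σ! = ∈-filter⁺ unique? (∈-allVecs n σ) σ!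

  ∈-Sn⁻ : ∀ {σ : Vec (Fin n) n} → σ ∈ Sn n → Unique (toList σ)
  ∈-Sn⁻ σ∈ = proj₂ (∈-filter⁻ unique? {xs = allVecs n} σ∈)

  Sn-unique : Unique (Sn n)
  Sn-unique = Unique.filter⁺ unique? (allVecs-unique n)

  map-complement-Sn-↭ : map complement (Sn n) ↭ Sn n
  map-complement-Sn-↭ = map-involution-↭ complement-involutive Sn-unique
    (λ {σ} σ∈ → ∈-Sn⁺ (complement-unique σ (∈-Sn⁻ σ∈)))

module LowerBound (K : ℕ) {n : ℕ} (d : Vec (Fin n) n → ℕ)
  (d-reaches : ∀ σ → Unique (toList σ) → Reach K (d σ) (toList (idPerm n)) (toList σ))
  where

  open OrderStatistics (Fin.<-isStrictTotalOrder {n})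

  descents-bound : ∀ σ → Unique (toList σ) → descents (toList σ) + 3 ≤ 2 ^ d σ * 3
  descents-bound σ σ! = subst (λ D → descents (toList σ) + 3 ≤ 2 ^ d σ * (D + 3))
                          (descents-sorted idPerm-sorted) (descents-Reach (d-reaches σ σ!))

  inversions-bound : ∀ σ → Unique (toList σ) → inversions (toList σ) ≤ d σ * K ^ 2
  inversions-bound σ σ! = subst (λ I → inversions (toList σ) ≤ I + d σ * K ^ 2)
                            (inversions-sorted idPerm-sorted) (inversions-Reach (d-reaches σ σ!))

  complement-inversions-bound : ∀ σ → Unique (toList σ) → n C 2 ≤ (d σ + d (complement σ)) * K ^ 2
  complement-inversions-bound σ σ! = begin
    n C 2                                          ≡⟨ cong (_C 2) (Vec.length-toList σ) ⟨
    length (toList σ) C 2                          ≤⟨ inversions-complementary opposite-< (toList σ) σ! ⟩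
    inversions (toList σ) + inversions (map opposite (toList σ))
      ≡⟨ cong (λ l → inversions (toList σ) + inversions l) (toList-complement σ) ⟨
    inversions (toList σ) + inversions (toList σ̄)
      ≤⟨ +-mono-≤ (inversions-bound σ σ!) (inversions-bound σ̄ (complement-unique σ σ!)) ⟩
    d σ * K ^ 2 + d σ̄ * K ^ 2                      ≡⟨ *-distribʳ-+ (K ^ 2) (d σ) (d σ̄) ⟨
    (d σ + d σ̄) * K ^ 2                            ∎
    where
    open ≤-Reasoning
    σ̄ = complement σ

  complement-descents-bound : ∀ σ → Unique (toList σ) → n ≤ 2 ^ (d σ + d (complement σ) + 3)
  complement-descents-bound σ σ! =
    n≤2^[t+t′+3] (d σ) (d σ̄) runs (descents-bound σ σ!) (descents-bound σ̄ (complement-unique σ σ!))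
    where
    σ̄ = complement σ
    runs : n ≤ descents (toList σ) + suc (descents (toList σ̄))
    runs = subst₂ (λ m l → m ≤ descents (toList σ) + suc (descents l))
             (Vec.length-toList σ) (sym (toList-complement σ))
             (descents-complementary opposite-< (toList σ) σ!)

  complement-pair-bound : 2 ≤ n → ∀ σ → Unique (toList σ) →
    ⌊log₂ n ⌋ * K ^ 2 + n ^ 2 ≤ 8 * K ^ 2 * (d σ + d (complement σ))
  complement-pair-bound 2≤n σ σ! = begin
    ⌊log₂ n ⌋ * K ^ 2 + n ^ 2       ≤⟨ +-mono-≤ (*-monoˡ-≤ (K ^ 2) log-bound) square-bound ⟩
    4 * s * K ^ 2 + 4 * (s * K ^ 2) ≡⟨ regroup s (K ^ 2) ⟩
    8 * K ^ 2 * s                   ∎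
    where
    open ≤-Reasoning
    s = d σ + d (complement σ)
    pairs-bound : n C 2 ≤ s * K ^ 2
    pairs-bound = complement-inversions-bound σ σ!
    log-bound : ⌊log₂ n ⌋ ≤ 4 * s
    log-bound = ⌊log₂⌋≤4* (1≤m*n⇒1≤m s (≤-trans (1≤nC2 2≤n) pairs-bound))
                          (complement-descents-bound σ σ!)
    square-bound : n ^ 2 ≤ 4 * (s * K ^ 2)
    square-bound = ≤-trans (n^2≤4*nC2 2≤n) (*-monoʳ-≤ 4 pairs-bound)
    regroup : ∀ s k → 4 * s * k + 4 * (s * k) ≡ 8 * k * s
    regroup = solve-∀

  sum-complement : sum (map (d ∘ complement) (Sn n)) ≡ sum (map d (Sn n))
  sum-complement = trans (cong sum (map-∘ (Sn n))) (sum-↭ (map⁺ d map-complement-Sn-↭))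

  average-bound : 2 ≤ n →
    length (Sn n) * (⌊log₂ n ⌋ * K ^ 2 + n ^ 2) ≤ 16 * K ^ 2 * sum (map d (Sn n))
  average-bound 2≤n = begin
    length (Sn n) * (⌊log₂ n ⌋ * K ^ 2 + n ^ 2)
      ≤⟨ length*≤*sum (8 * K ^ 2) (λ σ → d σ + d (complement σ)) (Sn n)
           (λ σ∈ → complement-pair-bound 2≤n _ (∈-Sn⁻ σ∈)) ⟩
    8 * K ^ 2 * sum (map (λ σ → d σ + d (complement σ)) (Sn n))
      ≡⟨ cong (8 * K ^ 2 *_) (trans (sum-map-+ d (d ∘ complement) (Sn n))
                                    (cong (sum (map d (Sn n)) +_) sum-complement)) ⟩
    8 * K ^ 2 * (sum (map d (Sn n)) + sum (map d (Sn n)))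
      ≡⟨ regroup (K ^ 2) (sum (map d (Sn n))) ⟩
    16 * K ^ 2 * sum (map d (Sn n)) ∎
    where
    open ≤-Reasoning
    regroup : ∀ k S → 8 * k * (S + S) ≡ 16 * k * S
    regroup = solve-∀

proposition6 : (K : ℕ → ℕ) → (∀ n → 2 ≤ K n) →
    Σ ℕ λ a → Σ ℕ λ b → Σ ℕ λ N → (1 ≤ a) × (1 ≤ b) ×
      (∀ n → N ≤ n → (d : Vec (Fin n) n → ℕ) →
        (∀ σ → Unique (toList σ) → IsMinSteps (K n) (toList (idPerm n)) (toList σ) (d σ)) →
        a * length (Sn n) * (⌊log₂ n ⌋ * K n ^ 2 + n ^ 2)
          ≤ b * sum (map d (Sn n)) * K n ^ 2)
proposition6 K _ = 1 , 16 , 2 , ≤-refl , s≤s z≤n , bound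
  where
  bound : ∀ n → 2 ≤ n → (d : Vec (Fin n) n → ℕ) →
    (∀ σ → Unique (toList σ) → IsMinSteps (K n) (toList (idPerm n)) (toList σ) (d σ)) →
    1 * length (Sn n) * (⌊log₂ n ⌋ * K n ^ 2 + n ^ 2) ≤ 16 * sum (map d (Sn n)) * K n ^ 2
  bound n 2≤n d d-min = begin
    1 * length (Sn n) * c               ≡⟨ cong (_* c) (*-identityˡ (length (Sn n))) ⟩
    length (Sn n) * c
      ≤⟨ LowerBound.average-bound (K n) d (λ σ σ! → proj₁ (d-min σ σ!)) 2≤n ⟩
    16 * K n ^ 2 * sum (map d (Sn n))   ≡⟨ regroup (K n ^ 2) (sum (map d (Sn n))) ⟩
    16 * sum (map d (Sn n)) * K n ^ 2   ∎
    where
    open ≤-Reasoning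
    c = ⌊log₂ n ⌋ * K n ^ 2 + n ^ 2
    regroup : ∀ k S → 16 * k * S ≡ 16 * S * k
    regroup = solve-∀
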